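{- The graph $\mathrm{Cir}_9$ is not co-weakly triangle, i.e., its complement $\overline{\mathrm{Cir}_9}$ is not weakly triangle.
   Context: $\mathrm{Cir}_9$ is the graph on vertex set $\{1,\dots,9\}$ whose maximal stable sets are exactly $\{1,2,3\},\{4,5,6\},\{7,8,9\},\{1,4,7\},\{3,6,9\}$; i.e., two distinct vertices are adjacent iff they do not lie together in any of these five sets. A family of maximal stable sets of $G$ is non-edge covering if every two distinct non-adjacent vertices lie together in some member. A graph $G$ is weakly triangle if there is a non-edge covering family $\mathcal S$ of maximal stable sets of $G$ such that for every $S\in\mathcal S$ and every pair of adjacent vertices $u,v\in V(G)\setminus S$, $u$ and $v$ have a common neighbor in $S$. -}

module Defs where

open import Data.Nat using (ℕ)
open import Data.Fin using (Fin)
open import Data.Fin.Subset using (Subset; _∈_; _∉_; _⊆_; inside; outside)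
open import Data.Vec using (Vec; []; _∷_)
open import Data.List using (List; []; _∷_)
import Data.List.Membership.Propositional as L
open import Data.Product using (Σ; ∃; _×_; _,_)
open import Data.Empty using (⊥)
open import Relation.Nullary using (¬_)
open import Relation.Binary.PropositionalEquality using (_≡_; _≢_)

record Graph (n : ℕ) : Set₁ where
  field
    Adj    : Fin n → Fin n → Set
    sym    : ∀ {u v} → Adj u v → Adj v u
    irrefl : ∀ {u} → ¬ Adj u u
open Graph public

complement : ∀ {n} → Graph n → Graph n
complement G = record
  { Adj    = λ u v → u ≢ v × ¬ Adj G u v
  ; sym    = λ { (u≢v , ¬a) → (λ e → u≢v (Relation.Binary.PropositionalEquality.sym e)) , (λ a → ¬a (Graph.sym G a)) }
  ; irrefl = λ { (u≢u , _) → u≢u Relation.Binary.PropositionalEquality.refl }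
  }

module _ {n : ℕ} (G : Graph n) where

  Stable : Subset n → Set
  Stable S = ∀ u v → u ∈ S → v ∈ S → ¬ Adj G u v

  MaximalStable : Subset n → Set
  MaximalStable S = Stable S × (∀ T → Stable T → S ⊆ T → T ⊆ S)

  NonEdgeCovering : List (Subset n) → Set
  NonEdgeCovering 𝒮 = ∀ u v → u ≢ v → ¬ Adj G u v →
    ∃ λ S → S L.∈ 𝒮 × u ∈ S × v ∈ S

  WeaklyTriangle : Set
  WeaklyTriangle = ∃ λ (𝒮 : List (Subset n)) →
      (∀ S → S L.∈ 𝒮 → MaximalStable S)
    × NonEdgeCovering 𝒮
    × (∀ S → S L.∈ 𝒮 → ∀ u v → u ∉ S → v ∉ S → Adj G u v →
         ∃ λ w → w ∈ S × Adj G u w × Adj G w v)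

-- Cir₉: vertices 1..9 are represented by Fin 9 elements 0..8 (vertex i ↦ i-1).
-- The five designated sets {1,2,3},{4,5,6},{7,8,9},{1,4,7},{3,6,9}.
cirSets : List (Subset 9)
cirSets =
    (inside ∷ inside ∷ inside ∷ outside ∷ outside ∷ outside ∷ outside ∷ outside ∷ outside ∷ [])
  ∷ (outside ∷ outside ∷ outside ∷ inside ∷ inside ∷ inside ∷ outside ∷ outside ∷ outside ∷ [])
  ∷ (outside ∷ outside ∷ outside ∷ outside ∷ outside ∷ outside ∷ inside ∷ inside ∷ inside ∷ [])
  ∷ (inside ∷ outside ∷ outside ∷ inside ∷ outside ∷ outside ∷ inside ∷ outside ∷ outside ∷ [])
  ∷ (outside ∷ outside ∷ inside ∷ outside ∷ outside ∷ inside ∷ outside ∷ outside ∷ inside ∷ [])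
  ∷ []

CirAdj : Fin 9 → Fin 9 → Set
CirAdj u v = u ≢ v × ¬ (∃ λ T → T L.∈ cirSets × u ∈ T × v ∈ T)

Cir9 : Graph 9
Cir9 = record
  { Adj    = CirAdj
  ; sym    = λ { (u≢v , ¬t) → (λ e → u≢v (Relation.Binary.PropositionalEquality.sym e))
                             , (λ { (T , m , v∈ , u∈) → ¬t (T , m , u∈ , v∈) }) }
  ; irrefl = λ { (u≢u , _) → u≢u Relation.Binary.PropositionalEquality.refl }
  }

module Submission where

-- Vertices of Cir₉ are 1..9, represented by Fin 9 (vertex k is `# (k - 1)`); write
-- H for the complement of Cir₉.  Two distinct vertices are adjacent in H iff they lie
-- together in one of the five designated sets, so H is computable, and so is every
-- finite question about it.
--
-- Suppose 𝒮 witnesses that H is weakly triangle.  Vertices 2 and 5 share no designated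
-- set, hence are non-adjacent in H and lie in a common S ∈ 𝒮.  Since S is stable, every
-- H-neighbour of 2 or 5 lies outside S.  The general lemma `forced-common-neighbour`
-- says: if u, v are adjacent, both outside S, and c is their only common neighbour,
-- then the triangle condition puts c into S.  Now 3 and 6 (neighbours of 2 and 5) have
-- 9 as their only common neighbour, and 1 and 4 (also neighbours of 2 and 5) have 7 as
-- theirs; so 7, 9 ∈ S, yet 7 and 9 are adjacent in H, contradicting stability of S.

open import Defs
open import Data.Fin using (Fin; #_; _≟_)
open import Data.Fin.Subset using (Subset; _∈_; _∉_)
open import Data.Fin.Subset.Properties using (_∈?_)
open import Data.Fin.Properties using (all?)
open import Data.List.Relation.Unary.Any using (any?)
open import Data.Product using (∃; _×_; _,_; proj₁)
open import Relation.Nullary using (¬_; Dec)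
open import Relation.Nullary.Decidable using (True; toWitness; map′; ¬?; _×-dec_; _→-dec_)
open import Relation.Binary.PropositionalEquality using (_≡_; subst)
import Data.List.Membership.Propositional as L
open L using (find; lose)

CommonNeighbourIn : ∀ {n} → Graph n → Subset n → Fin n → Fin n → Set
CommonNeighbourIn G S u v = ∃ λ w → w ∈ S × Adj G u w × Adj G w v

neighbour-outside : ∀ {n} (G : Graph n) {S : Subset n} {x u : Fin n} →
  Stable G S → x ∈ S → Adj G u x → u ∉ S
neighbour-outside G stable x∈S u~x u∈S = stable _ _ u∈S x∈S u~x

forced-common-neighbour : ∀ {n} (G : Graph n) {S : Subset n} {u v c : Fin n} →
  (∀ u v → u ∉ S → v ∉ S → Adj G u v → CommonNeighbourIn G S u v) →
  u ∉ S → v ∉ S → Adj G u v →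
  (∀ w → Adj G u w → Adj G w v → w ≡ c) → c ∈ S
forced-common-neighbour G {S} triangle u∉S v∉S u~v unique
  with triangle _ _ u∉S v∉S u~v
... | w , w∈S , u~w , w~v = subst (_∈ S) (unique w u~w w~v) w∈S

H : Graph 9
H = complement Cir9

together? : ∀ u v → Dec (∃ λ T → T L.∈ cirSets × u ∈ T × v ∈ T)
together? u v = map′ find (λ { (T , T∈ , both) → lose T∈ both })
                      (any? (λ T → (u ∈? T) ×-dec (v ∈? T)) cirSets)

-- Adjacency in H is decidable, unfolding the two complements in its definition.
adj? : ∀ u v → Dec (Adj H u v)
adj? u v = ¬? (u ≟ v) ×-dec ¬? (¬? (u ≟ v) ×-dec ¬? (together? u v))

edge : ∀ u v → {True (adj? u v)} → Adj H u v
edge u v {t} = toWitness t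

non-edge : ∀ u v → {True (¬? (adj? u v))} → ¬ Adj H u v
non-edge u v {t} = toWitness t

only-common-neighbour : ∀ u v c →
  {True (all? λ w → adj? u w →-dec (adj? w v →-dec (w ≟ c)))} →
  ∀ w → Adj H u w → Adj H w v → w ≡ c
only-common-neighbour u v c {t} = toWitness t

proposition43 : ¬ WeaklyTriangle (complement Cir9)
proposition43 (𝒮 , maximal , covering , triangle)
  with covering (# 1) (# 4) (λ ()) (non-edge (# 1) (# 4))
... | S , S∈𝒮 , 2∈S , 5∈S = stable (# 6) (# 8) 7∈S 9∈S (edge (# 6) (# 8))
  where
  stable : Stable H S
  stable = proj₁ (maximal S S∈𝒮)

  outside : ∀ u x → x ∈ S → {True (adj? u x)} → u ∉ S
  outside u x x∈S {t} = neighbour-outside H stable x∈S (toWitness t)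

  forced : ∀ u v c → u ∉ S → v ∉ S → Adj H u v →
           (∀ w → Adj H u w → Adj H w v → w ≡ c) → c ∈ S
  forced u v c = forced-common-neighbour H (triangle S S∈𝒮)

  9∈S : # 8 ∈ S
  9∈S = forced (# 2) (# 5) (# 8) (outside (# 2) (# 1) 2∈S) (outside (# 5) (# 4) 5∈S)
          (edge (# 2) (# 5)) (only-common-neighbour (# 2) (# 5) (# 8))

  7∈S : # 6 ∈ S
  7∈S = forced (# 0) (# 3) (# 6) (outside (# 0) (# 1) 2∈S) (outside (# 3) (# 4) 5∈S)
          (edge (# 0) (# 3)) (only-common-neighbour (# 0) (# 3) (# 6))
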